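{- Let $G=(X,Y,E)$ be a 2-layer network in which every vertex of $Y$ has degree at least $1$, let $<_X$ be a linear order of $X$ such that the one-sided local crossing number of $(G,<_X)$ is $k$, and let $<_{\mathsf A}$ be any order of $Y$ that can be returned by heuristic $\mathsf A$. Then every median edge crosses at most $k$ edges in the 2-layer drawing $(<_X,<_{\mathsf A})$.
   Context: A 2-layer network $(X,Y,E)$ is a finite bipartite graph with vertex set $X\cup Y$, $X\cap Y=\emptyset$, edges written $(x,y)$ with $x\in X,y\in Y$. A 2-layer drawing is a pair $(<_X,<_Y)$ of linear orders of $X$ and $Y$; edges $(x_1,y_1),(x_2,y_2)$ cross iff $(x_1<_X x_2\wedge y_2<_Y y_1)$ or $(x_2<_X x_1\wedge y_1<_Y y_2)$. The local crossing number of a drawing is the minimum $k$ such that every edge crosses at most $k$ edges; the one-sided local crossing number of $(G,<_X)$ is the minimum over all linear orders $<_Y$ of $Y$ of the local crossing number of $(<_X,<_Y)$. Heuristic $\mathsf A$: for each $y\in Y$ list its neighbors in increasing $<_X$ order (1-indexed). The median $\mathrm{med}(y)$ is the 2nd neighbor if $\deg(y)=2$, and the $\lfloor \deg(y)/2\rfloor$-th neighbor if $\deg(y)\neq 2$. The edge $(\mathrm{med}(y),y)$ is the median edge of $y$. Call $y$ a 2-vertex if $\deg(y)=2$, an odd vertex if $\deg(y)$ is odd, and a $4^{\oplus}$-vertex if $\deg(y)$ is even and at least $4$. For a 2-vertex $y$, its heavy neighbor is its neighbor other than $\mathrm{med}(y)$. The bunch of $x\in X$ is $\{y\in Y:\mathrm{med}(y)=x\}$.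 The output $<_{\mathsf A}$ is a linear order of $Y$ with $y_1<_{\mathsf A}y_2$ whenever $\mathrm{med}(y_1)<_X\mathrm{med}(y_2)$, and within each bunch: first the 2-vertices in ascending $<_X$-order of their heavy neighbors (ties broken arbitrarily), then the odd vertices in any order, then the $4^{\oplus}$-vertices in ascending order of degree (ties broken arbitrarily). -}

module Defs where

open import Data.Nat using (ℕ; zero; suc; _<_; _≤_; _<ᵇ_; _⊔_; _/_; _%_)
open import Data.Bool using (Bool; true; false; _∧_; _∨_)
open import Data.Fin using (Fin; toℕ)
open import Data.List using (List; []; _∷_; length; filterᵇ; allFin; cartesianProduct; map; foldr)
open import Data.Maybe using (Maybe; just; nothing)
open import Data.Product using (Σ; _×_; _,_; proj₁; proj₂)
open import Relation.Binary.PropositionalEquality using (_≡_)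
open import Relation.Nullary using (¬_)
open import Function.Definitions using (Injective)

-- The linear order <_X is
-- the natural order on Fin m (any linear order of a finite set is of this
-- form up to renaming).
Network : ℕ → ℕ → Set
Network m n = Fin m → Fin n → Bool

-- A linear order of Y = Fin n is given by an injective position map
-- π : Fin n → Fin n ; y₁ <_Y y₂ iff toℕ (π y₁) < toℕ (π y₂).
IsOrder : ∀ {n} → (Fin n → Fin n) → Set
IsOrder π = Injective _≡_ _≡_ π

module _ {m n : ℕ} (E : Network m n) where

  edges : List (Fin m × Fin n)
  edges = filterᵇ (λ p → E (proj₁ p) (proj₂ p)) (cartesianProduct (allFin m) (allFin n))

  crossᵇ : (Fin n → Fin n) → Fin m × Fin n → Fin m × Fin n → Bool
  crossᵇ π (x₁ , y₁) (x₂ , y₂) =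
    ((toℕ x₁ <ᵇ toℕ x₂) ∧ (toℕ (π y₂) <ᵇ toℕ (π y₁)))
    ∨ ((toℕ x₂ <ᵇ toℕ x₁) ∧ (toℕ (π y₁) <ᵇ toℕ (π y₂)))

  crossings : (Fin n → Fin n) → Fin m × Fin n → ℕ
  crossings π e = length (filterᵇ (crossᵇ π e) edges)

  -- local crossing number of the drawing: max over edges of crossings
  -- (= the minimum k such that every edge crosses at most k edges)
  lcn : (Fin n → Fin n) → ℕ
  lcn π = foldr _⊔_ 0 (map (crossings π) edges)

  OneSidedLCN≡ : ℕ → Set
  OneSidedLCN≡ k =
    (Σ (Fin n → Fin n) λ π → IsOrder π × lcn π ≡ k)
    × (∀ π → IsOrder π → k ≤ lcn π)

  -- neighbours of y in increasing <_X order
  nbrs : Fin n → List (Fin m)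
  nbrs y = filterᵇ (λ x → E x y) (allFin m)

  deg : Fin n → ℕ
  deg y = length (nbrs y)

  -- 0-indexed lookup
  nth : ∀ {A : Set} → List A → ℕ → Maybe A
  nth []       _       = nothing
  nth (a ∷ as) zero    = just a
  nth (a ∷ as) (suc i) = nth as i

  -- 1-indexed position of the median: 2 if deg = 2, else ⌈deg/2⌉
  medPos : ℕ → ℕ
  medPos 2 = 2
  medPos d = (suc d) / 2

  IsMed : Fin n → Fin m → Set
  IsMed y x = nth (nbrs y) (medPos (deg y) Data.Nat.∸ 1) ≡ just x

  IsHeavy : Fin n → Fin m → Set
  IsHeavy y x = deg y ≡ 2 × E x y ≡ true × ¬ IsMed y x

  -- class within a bunch: 0 = 2-vertex, 1 = odd vertex, 2 = 4⊕-vertex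
  rank : Fin n → ℕ
  rank y with deg y
  ... | 2 = 0
  ... | d with d % 2
  ...   | 0 = 2
  ...   | _ = 1

  _<π_ : (Fin n → Fin n) → Fin n → Fin n → Set
  _<π_ π y₁ y₂ = toℕ (π y₁) < toℕ (π y₂)

  HeuristicA : (Fin n → Fin n) → Set
  HeuristicA π =
    IsOrder π
    × (∀ y₁ y₂ x₁ x₂ → IsMed y₁ x₁ → IsMed y₂ x₂ → toℕ x₁ < toℕ x₂ → _<π_ π y₁ y₂)
    × (∀ y₁ y₂ x → IsMed y₁ x → IsMed y₂ x → rank y₁ < rank y₂ → _<π_ π y₁ y₂)
    × (∀ y₁ y₂ x h₁ h₂ → IsMed y₁ x → IsMed y₂ x → IsHeavy y₁ h₁ → IsHeavy y₂ h₂
         → toℕ h₁ < toℕ h₂ → _<π_ π y₁ y₂)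
    × (∀ y₁ y₂ x → IsMed y₁ x → IsMed y₂ x → rank y₁ ≡ 2 → rank y₂ ≡ 2
         → deg y₁ < deg y₂ → _<π_ π y₁ y₂)

{-# OPTIONS --safe #-}
module Submission where

-- Fix an order σ of Y whose local crossing number is k.  The
-- crossings of a median edge (x , y) can be counted vertex by vertex: a
-- vertex w ≠ y contributes the number of its neighbours left of x if it is
-- drawn after y, and right of x if it is drawn before y.  The smaller of these
-- two numbers is paid in every drawing, and heuristic A pays no more than that,
-- except possibly for 2-vertices of the bunch of x when y is a 2-vertex, and
-- for 4⊕-vertices of the bunch drawn before y when y is a 4⊕-vertex.  These
-- are handled by a partner z in the bunch of x: y itself if y is odd, the
-- σ-first 2-vertex of the bunch if y is a 2-vertex, and, if y is a
-- 4⊕-vertex, the σ-last among the 4⊕-vertices of the bunch that A draws no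
-- later than y.  After exchanging y and z, the crossings of (x , y) under A
-- are bounded vertex by vertex by those of the edge (x , z) under σ, which
-- are at most k.

open import Defs
open import Data.Nat as ℕ
  using (ℕ; zero; suc; _+_; _*_; _∸_; _≤_; _<_; _⊓_; _⊔_; _<ᵇ_; z≤n; s≤s)
open import Data.Fin using (Fin; zero; suc; toℕ)
open import Data.Product using (_,_; ∃; ∃₂; _×_; proj₁; proj₂)

open import Data.Bool using (Bool; true; false; T; _∧_; _∨_; T?)
open import Data.Bool.Properties using (∧-zeroʳ; ∧-identityʳ; ∨-identityʳ)
open import Data.Empty using (⊥-elim)
import Data.Fin.Permutation as Perm
import Data.Fin.Properties as Fin
open import Data.List
  using (List; []; _∷_; _++_; length; map; filter; filterᵇ; tabulate; cartesianProduct; foldr; allFin)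
open import Data.List.Extrema.Nat
  using (argmin; argmax; argmin-all; argmax-all; f[argmin]≤v⁺; v≤f[argmax]⁺)
open import Data.List.Membership.Propositional using (_∈_; lose)
open import Data.List.Membership.Propositional.Properties
  using (∈-filter⁺; ∈-filter⁻; ∈-allFin; ∈-++⁺ʳ; ∈-cartesianProduct⁺)
open import Data.List.Properties
  using (filter-++; length-++; filter-accept; filter-reject; filter-all; filter-none)
open import Data.List.Relation.Unary.All as All using (All)
open import Data.List.Relation.Unary.All.Properties using (++⁻ʳ; all-filter)
open import Data.List.Relation.Unary.AllPairs using (AllPairs; _∷_)
import Data.List.Relation.Unary.AllPairs.Properties as AllPairs
open import Data.List.Relation.Unary.Any using (here; there)
open import Data.Maybe using (just)
import Data.Maybe.Properties as Maybe
open import Data.Nat.DivMod using ([m+kn]%n≡m%n; m*n/n≡m; +-distrib-/-∣ʳ)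
open import Data.Nat.Divisibility using (divides)
open import Data.Nat.Properties as ℕ
  using ( ≤-refl; ≤-reflexive; ≤-trans; <⇒≤; <-≤-trans; ≤-<-trans; <-trans; <-cmp; ≤∧≢⇒<
        ; n≮n; <⇒≯; <ᵇ⇒<; <⇒<ᵇ; +-mono-≤; +-cancelˡ-≡; m≤m*n; m≤n+m
        ; m⊓n≤m; m⊓n≤n; m≤m⊔n; m≤n⊔m; m≤n⇒m⊓n≡m; m≥n⇒m⊓n≡n)
open import Data.Nat.Tactic.RingSolver using (solve-∀)
open import Data.Sum using (_⊎_; inj₁; inj₂)
open import Function using (_∘_; id; flip)
open import Level using (0ℓ)
open import Relation.Binary.Definitions using (tri<; tri≈; tri>)
open import Relation.Binary.PropositionalEquality
  using (_≡_; _≢_; refl; sym; trans; cong; cong₂; subst; subst₂; module ≡-Reasoning)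
open import Relation.Nullary using (¬_; Dec; contradiction; yes; no)
open import Relation.Nullary.Decidable using (dec-true; dec-false; _×-dec_; _⊎-dec_)
open import Relation.Unary using (Pred; Decidable)

open import Algebra.Properties.CommutativeMonoid.Sum ℕ.+-0-commutativeMonoid
  using (sum-syntax; ∑-comm; sum-cong-≗; sum-permute)

indicator : Bool → ℕ
indicator true  = 1
indicator false = 0

count : {A : Set} → (A → Bool) → List A → ℕ
count p xs = length (filterᵇ p xs)

private
  variable
    A B : Set

<ᵇ-irrefl : ∀ n → ¬ T (n <ᵇ n)
<ᵇ-irrefl n = n≮n n ∘ <ᵇ⇒< n n

<ᵇ-true : ∀ {m n} → m < n → (m <ᵇ n) ≡ true
<ᵇ-true {m} {n} m<n = dec-true (T? (m <ᵇ n)) (<⇒<ᵇ m<n)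

<ᵇ-false : ∀ {m n} → ¬ m < n → (m <ᵇ n) ≡ false
<ᵇ-false {m} {n} m≮n = dec-false (T? (m <ᵇ n)) (m≮n ∘ <ᵇ⇒< m n)

count-++ : ∀ (p : A → Bool) xs ys → count p (xs ++ ys) ≡ count p xs + count p ys
count-++ p xs ys = trans (cong length (filter-++ (T? ∘ p) xs ys)) (length-++ (filterᵇ p xs))

count-filterᵇ : ∀ (p q : A → Bool) xs → count q (filterᵇ p xs) ≡ count (λ a → p a ∧ q a) xs
count-filterᵇ p q []       = refl
count-filterᵇ p q (a ∷ xs) with p a
... | false = count-filterᵇ p q xs
... | true with q a
...   | true  = cong suc (count-filterᵇ p q xs)
...   | false = count-filterᵇ p q xs

count-cong : ∀ {p q : A → Bool} → (∀ a → p a ≡ q a) → ∀ xs → count p xs ≡ count q xs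
count-cong p≗q []       = refl
count-cong {q = q} p≗q (a ∷ xs) rewrite p≗q a with q a
... | true  = cong suc (count-cong p≗q xs)
... | false = count-cong p≗q xs

count-mono : ∀ {p q : A → Bool} → (∀ a → T (p a) → T (q a)) → ∀ xs → count p xs ≤ count q xs
count-mono p⇒q []       = z≤n
count-mono {p = p} {q} p⇒q (a ∷ xs) with p a | q a | p⇒q a
... | false | false | _    = count-mono p⇒q xs
... | false | true  | _    = ℕ.m≤n⇒m≤1+n (count-mono p⇒q xs)
... | true  | true  | _    = s≤s (count-mono p⇒q xs)
... | true  | false | pa⇒qa = ⊥-elim (pa⇒qa _)

count-mono-< : ∀ {p q : A → Bool} {a xs} → (∀ b → T (p b) → T (q b)) →
               a ∈ xs → T (q a) → ¬ T (p a) → count p xs < count q xs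
count-mono-< {p = p} {q} {a} {a ∷ xs} p⇒q (here refl) qa ¬pa
  rewrite filter-reject (T? ∘ p) {xs = xs} ¬pa | filter-accept (T? ∘ q) {xs = xs} qa
  = s≤s (count-mono p⇒q xs)
count-mono-< {p = p} {q} {xs = b ∷ xs} p⇒q (there a∈xs) qa ¬pa with p b | q b | p⇒q b
... | false | false | _     = count-mono-< p⇒q a∈xs qa ¬pa
... | false | true  | _     = ℕ.m≤n⇒m≤1+n (count-mono-< p⇒q a∈xs qa ¬pa)
... | true  | true  | _     = s≤s (count-mono-< p⇒q a∈xs qa ¬pa)
... | true  | false | pb⇒qb = ⊥-elim (pb⇒qb _)

count-none : ∀ {p : A → Bool} {xs} → All (λ a → ¬ T (p a)) xs → count p xs ≡ 0
count-none {p = p} none = cong length (filter-none (T? ∘ p) none)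

count-all : ∀ {p : A → Bool} {xs} → All (λ a → T (p a)) xs → count p xs ≡ length xs
count-all {p = p} all = cong length (filter-all (T? ∘ p) all)

count-tabulate : ∀ {k} (p : A → Bool) (f : Fin k → A) →
                 count p (tabulate f) ≡ ∑[ i < k ] indicator (p (f i))
count-tabulate {k = zero}  p f = refl
count-tabulate {k = suc k} p f with p (f zero)
... | true  = cong suc (count-tabulate p (f ∘ suc))
... | false = count-tabulate p (f ∘ suc)

count-map : ∀ (p : B → Bool) (g : A → B) xs → count p (map g xs) ≡ count (p ∘ g) xs
count-map p g []       = refl
count-map p g (a ∷ xs) with p (g a)
... | true  = cong suc (count-map p g xs)
... | false = count-map p g xs

count-cartesianProduct : ∀ {k} (p : A × B → Bool) (f : Fin k → A) ys →
  count p (cartesianProduct (tabulate f) ys) ≡ ∑[ i < k ] count (λ b → p (f i , b)) ys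
count-cartesianProduct {k = zero}  p f ys = refl
count-cartesianProduct {k = suc k} p f ys =
  trans (count-++ p (map (f zero ,_) ys) (cartesianProduct (tabulate (f ∘ suc)) ys))
        (cong₂ _+_ (count-map p (f zero ,_) ys) (count-cartesianProduct p (f ∘ suc) ys))

module _ {A : Set} (f : A → ℕ) where

  count-below-sorted : ∀ {x} ys zs → AllPairs (λ u v → f u < f v) (ys ++ x ∷ zs) →
                       count (λ u → f u <ᵇ f x) (ys ++ x ∷ zs) ≡ length ys
  count-below-sorted {x} [] zs (x<zs ∷ _) = trans
    (cong length (filter-reject (T? ∘ λ u → f u <ᵇ f x) (<ᵇ-irrefl (f x))))
    (count-none (All.map (λ x<u → <⇒≯ x<u ∘ <ᵇ⇒< _ _) x<zs))
  count-below-sorted {x} (y ∷ ys) zs (y<rest ∷ rest) = trans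
    (cong length (filter-accept (T? ∘ λ u → f u <ᵇ f x) (<⇒<ᵇ (All.head (++⁻ʳ ys y<rest)))))
    (cong suc (count-below-sorted ys zs rest))

  count-above-sorted : ∀ {x} ys zs → AllPairs (λ u v → f u < f v) (ys ++ x ∷ zs) →
                       count (λ u → f x <ᵇ f u) (ys ++ x ∷ zs) ≡ length zs
  count-above-sorted {x} [] zs (x<zs ∷ _) = trans
    (cong length (filter-reject (T? ∘ λ u → f x <ᵇ f u) (<ᵇ-irrefl (f x))))
    (count-all (All.map <⇒<ᵇ x<zs))
  count-above-sorted {x} (y ∷ ys) zs (y<rest ∷ rest) = trans
    (cong length (filter-reject (T? ∘ λ u → f x <ᵇ f u) (<⇒≯ (All.head (++⁻ʳ ys y<rest)) ∘ <ᵇ⇒< _ _)))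
    (count-above-sorted ys zs rest)

∑-mono-≤ : ∀ {k} {f g : Fin k → ℕ} → (∀ i → f i ≤ g i) → ∑[ i < k ] f i ≤ ∑[ i < k ] g i
∑-mono-≤ {zero}  f≤g = z≤n
∑-mono-≤ {suc k} f≤g = +-mono-≤ (f≤g zero) (∑-mono-≤ (f≤g ∘ suc))

∑-≤-swap : ∀ {k} {f g : Fin k → ℕ} y z → f y ≤ g z → (y ≢ z → f z ≤ g y) →
           (∀ w → w ≢ y → w ≢ z → f w ≤ g w) → ∑[ i < k ] f i ≤ ∑[ i < k ] g i
∑-≤-swap {f = f} {g} y z fy≤gz fz≤gy f≤g =
  ≤-trans (∑-mono-≤ f≤g∘swap) (≤-reflexive (sym (sum-permute g (Perm.transpose y z))))
  where
  f≤g∘swap : ∀ w → f w ≤ g (Perm.transpose y z Perm.⟨$⟩ʳ w)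
  f≤g∘swap w with w Fin.≟ y
  ... | yes refl = fy≤gz
  ... | no w≢y with w Fin.≟ z
  ...   | yes refl = fz≤gy (w≢y ∘ sym)
  ...   | no w≢z   = f≤g w w≢y w≢z

module _ {k : ℕ} {P : Pred (Fin k) 0ℓ} (P? : Decidable P) (f : Fin k → ℕ) {y : Fin k} (Py : P y) where

  ∃-argmin : ∃ λ z → P z × (∀ w → P w → f z ≤ f w)
  ∃-argmin = argmin f y ws , argmin-all f Py (all-filter P? (allFin k)) ,
    λ w Pw → f[argmin]≤v⁺ y ws (inj₂ (lose (∈-filter⁺ P? (∈-allFin w) Pw) ≤-refl))
    where ws = filter P? (allFin k)

  ∃-argmax : ∃ λ z → P z × (∀ w → P w → f w ≤ f z)
  ∃-argmax = argmax f y ws , argmax-all f Py (all-filter P? (allFin k)) ,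
    λ w Pw → v≤f[argmax]⁺ y ws (inj₂ (lose (∈-filter⁺ P? (∈-allFin w) Pw) ≤-refl))
    where ws = filter P? (allFin k)

≤-foldr-⊔ : ∀ (f : A → ℕ) {a xs} → a ∈ xs → f a ≤ foldr _⊔_ 0 (map f xs)
≤-foldr-⊔ f {xs = b ∷ xs} (here refl) = ℕ.m≤m⊔n (f b) _
≤-foldr-⊔ f {xs = b ∷ xs} (there a∈xs) = ≤-trans (≤-foldr-⊔ f a∈xs) (ℕ.m≤n⊔m (f b) _)

≡0⇒≤ : ∀ {l r} → r ≡ 0 → r ≤ l
≡0⇒≤ refl = z≤n

≡suc⇒≤ : ∀ {l r} → r ≡ suc l → l ≤ r
≡suc⇒≤ refl = ℕ.n≤1+n _

≡⇒⊔≤⊓ : ∀ {l r} → r ≡ l → l ⊔ r ≤ l ⊓ r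
≡⇒⊔≤⊓ {l} refl = ≤-reflexive (trans (ℕ.⊔-idem l) (sym (ℕ.⊓-idem l)))

data Halves : ℕ → Set where
  even : ∀ t → Halves (t * 2)
  odd  : ∀ t → Halves (suc (t * 2))

halves : ∀ d → Halves d
halves zero = even 0
halves (suc d) with halves d
... | even t = odd t
... | odd t  = even (suc t)

data DegreeKind : ℕ → ℕ → Set where
  two  : DegreeKind 0 2
  odd  : ∀ t → DegreeKind 1 (suc (t * 2))
  even : ∀ t → DegreeKind 2 (4 + t * 2)

data MedianSplit (rk d left right : ℕ) : Set where
  two  : rk ≡ 0 → left ≡ 1 → right ≡ 0 → MedianSplit rk d left right
  odd  : rk ≡ 1 → right ≡ left → MedianSplit rk d left right
  even : rk ≡ 2 → right ≡ suc left → d ≡ 2 + left * 2 → MedianSplit rk d left right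

private
  cancel-double : ∀ s l ρ → l + suc ρ ≡ s + suc (l * 2) → ρ ≡ s + l
  cancel-double s l ρ eq = ℕ.suc-injective (+-cancelˡ-≡ l _ _ (trans eq (shuffle s l)))
    where
    shuffle : ∀ s l → s + suc (l * 2) ≡ l + suc (s + l)
    shuffle = solve-∀

module _ {m n : ℕ} (E : Network m n) where

  degreeKind : ∀ y → 1 ≤ deg E y → DegreeKind (rank E y) (deg E y)
  degreeKind y 1≤d with deg E y | halves (deg E y)
  ... | _ | even zero           = contradiction 1≤d λ ()
  ... | _ | even 1              = two
  ... | _ | even (suc (suc t)) rewrite [m+kn]%n≡m%n 4 t 2 ⦃ _ ⦄ = even t
  ... | _ | odd zero            = odd 0
  ... | _ | odd (suc t)         rewrite [m+kn]%n≡m%n 3 t 2 ⦃ _ ⦄ = odd (suc t)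

  medPos-odd : ∀ t → medPos E (suc (t * 2)) ≡ suc t
  medPos-odd zero    = refl
  medPos-odd (suc t) = m*n/n≡m (2 + t) 2

  medPos-even : ∀ t → medPos E (4 + t * 2) ≡ 2 + t
  medPos-even t = trans (+-distrib-/-∣ʳ 1 {d = 2} (divides (2 + t) refl)) (m*n/n≡m (2 + t) 2)

  medianSplit-ℕ : ∀ {r d l ρ} → DegreeKind r d → l ≡ medPos E d ∸ 1 → l + suc ρ ≡ d →
                  MedianSplit r d l ρ
  medianSplit-ℕ two      refl refl = two refl refl refl
  medianSplit-ℕ (odd t)  l≡ l+1+ρ≡d with trans l≡ (cong (_∸ 1) (medPos-odd t))
  ... | refl = odd refl (cancel-double 0 t _ l+1+ρ≡d)
  medianSplit-ℕ (even t) l≡ l+1+ρ≡d with trans l≡ (cong (_∸ 1) (medPos-even t))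
  ... | refl = even refl (cancel-double 1 (suc t) _ l+1+ρ≡d) refl

  medPos∸1<d : ∀ {r d} → DegreeKind r d → medPos E d ∸ 1 < d
  medPos∸1<d two      = s≤s (s≤s z≤n)
  medPos∸1<d (odd t)  rewrite medPos-odd t = s≤s (m≤m*n t 2)
  medPos∸1<d (even t) rewrite medPos-even t = s≤s (s≤s (≤-trans (m≤m*n t 2) (m≤n+m _ 2)))

  nth-split : ∀ {a : A} xs i → nth E xs i ≡ just a → ∃₂ λ ys zs → xs ≡ ys ++ a ∷ zs × length ys ≡ i
  nth-split (b ∷ xs) zero    refl = [] , xs , refl , refl
  nth-split (b ∷ xs) (suc i) eq with nth-split xs i eq
  ... | ys , zs , refl , refl = b ∷ ys , zs , refl , refl

  nth-just : ∀ (xs : List A) {i} → i < length xs → ∃ λ a → nth E xs i ≡ just a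
  nth-just (a ∷ xs) {zero}  _         = a , refl
  nth-just (a ∷ xs) {suc i} (s≤s i<n) = nth-just xs i<n

  ∈-nbrs : ∀ {x w} → T (E x w) → x ∈ nbrs E w
  ∈-nbrs {x} {w} = ∈-filter⁺ (T? ∘ λ j → E j w) (∈-allFin x)

  nbrs-sorted : ∀ w → AllPairs (λ u v → toℕ u < toℕ v) (nbrs E w)
  nbrs-sorted w = AllPairs.filter⁺ (T? ∘ λ j → E j w) (AllPairs.tabulate⁺-< id)

  #leftOf #rightOf : Fin m → Fin n → ℕ
  #leftOf  x w = count (λ j → toℕ j <ᵇ toℕ x) (nbrs E w)
  #rightOf x w = count (λ j → toℕ x <ᵇ toℕ j) (nbrs E w)

  module _ {w : Fin n} {x : Fin m} {ys zs : List (Fin m)} (nbrs≡ : nbrs E w ≡ ys ++ x ∷ zs) where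

    private
      sorted : AllPairs (λ u v → toℕ u < toℕ v) (ys ++ x ∷ zs)
      sorted = subst (AllPairs _) nbrs≡ (nbrs-sorted w)

    #leftOf-split : #leftOf x w ≡ length ys
    #leftOf-split = trans (cong (count _) nbrs≡) (count-below-sorted toℕ ys zs sorted)

    #rightOf-split : #rightOf x w ≡ length zs
    #rightOf-split = trans (cong (count _) nbrs≡) (count-above-sorted toℕ ys zs sorted)

    #left+#right-split : #leftOf x w + suc (#rightOf x w) ≡ deg E w
    #left+#right-split = begin
      #leftOf x w + suc (#rightOf x w)  ≡⟨ cong₂ (λ l r → l + suc r) #leftOf-split #rightOf-split ⟩
      length ys + length (x ∷ zs)       ≡⟨ length-++ ys ⟨
      length (ys ++ x ∷ zs)             ≡⟨ cong length nbrs≡ ⟨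
      deg E w                           ∎
      where open ≡-Reasoning

  module _ {w : Fin n} {x : Fin m} (x-med : IsMed E w x) where

    median-edge : T (E x w)
    median-edge with nth-split (nbrs E w) _ x-med
    ... | ys , _ , nbrs≡ , _ = proj₂ (∈-filter⁻ (T? ∘ λ j → E j w) {xs = allFin m}
      (subst (x ∈_) (sym nbrs≡) (∈-++⁺ʳ ys (here refl))))

    median-#leftOf : #leftOf x w ≡ medPos E (deg E w) ∸ 1
    median-#leftOf with nth-split (nbrs E w) _ x-med
    ... | _ , _ , nbrs≡ , ys-length = trans (#leftOf-split nbrs≡) ys-length

    median-#left+#right : #leftOf x w + suc (#rightOf x w) ≡ deg E w
    median-#left+#right with nth-split (nbrs E w) _ x-med
    ... | _ , _ , nbrs≡ , _ = #left+#right-split nbrs≡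

  medianSplit : ∀ {w x} → 1 ≤ deg E w → IsMed E w x →
                MedianSplit (rank E w) (deg E w) (#leftOf x w) (#rightOf x w)
  medianSplit {w} 1≤d x-med =
    medianSplit-ℕ (degreeKind w 1≤d) (median-#leftOf x-med) (median-#left+#right x-med)

  median-exists : ∀ w → 1 ≤ deg E w → ∃ (IsMed E w)
  median-exists w 1≤d = nth-just (nbrs E w) (medPos∸1<d (degreeKind w 1≤d))

  median-#left≤1+#right : ∀ {w x} → 1 ≤ deg E w → IsMed E w x → #leftOf x w ≤ suc (#rightOf x w)
  median-#left≤1+#right 1≤d x-med with medianSplit 1≤d x-med
  ... | two _ l≡1 r≡0     rewrite l≡1 | r≡0 = ≤-refl
  ... | odd _ r≡l         rewrite r≡l = ℕ.n≤1+n _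
  ... | even _ r≡1+l _    rewrite r≡1+l = ℕ.m≤n⇒m≤1+n (ℕ.n≤1+n _)

  median-#right≤1+#left : ∀ {w x} → 1 ≤ deg E w → IsMed E w x → #rightOf x w ≤ suc (#leftOf x w)
  median-#right≤1+#left 1≤d x-med with medianSplit 1≤d x-med
  ... | two _ l≡1 r≡0     rewrite l≡1 | r≡0 = z≤n
  ... | odd _ r≡l         rewrite r≡l = ℕ.n≤1+n _
  ... | even _ r≡1+l _    rewrite r≡1+l = ≤-refl

  #leftOf-mono : ∀ {x x' w} → toℕ x ≤ toℕ x' → #leftOf x w ≤ #leftOf x' w
  #leftOf-mono {x} {x'} {w} x≤x' =
    count-mono (λ j j<x → <⇒<ᵇ (<-≤-trans (<ᵇ⇒< (toℕ j) (toℕ x) j<x) x≤x')) (nbrs E w)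

  #rightOf-antimono : ∀ {x x' w} → toℕ x ≤ toℕ x' → #rightOf x' w ≤ #rightOf x w
  #rightOf-antimono {x} {x'} {w} x≤x' =
    count-mono (λ j x'<j → <⇒<ᵇ (≤-<-trans x≤x' (<ᵇ⇒< (toℕ x') (toℕ j) x'<j))) (nbrs E w)

  #leftOf-mono-< : ∀ {x x' w} → toℕ x' < toℕ x → T (E x' w) → #leftOf x' w < #leftOf x w
  #leftOf-mono-< {x} {x'} {w} x'<x x'w = count-mono-<
    (λ j j<x' → <⇒<ᵇ (<-trans (<ᵇ⇒< (toℕ j) (toℕ x') j<x') x'<x))
    (∈-nbrs x'w) (<⇒<ᵇ x'<x) (<ᵇ-irrefl (toℕ x'))

  #rightOf-antimono-< : ∀ {x x' w} → toℕ x < toℕ x' → T (E x' w) → #rightOf x' w < #rightOf x w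
  #rightOf-antimono-< {x} {x'} {w} x<x' x'w = count-mono-<
    (λ j x'<j → <⇒<ᵇ (<-trans x<x' (<ᵇ⇒< (toℕ x') (toℕ j) x'<j)))
    (∈-nbrs x'w) (<⇒<ᵇ x<x') (<ᵇ-irrefl (toℕ x'))

  #left≤#right-before-median : ∀ {w x x'} → 1 ≤ deg E w → IsMed E w x' → toℕ x < toℕ x' →
                               #leftOf x w ≤ #rightOf x w
  #left≤#right-before-median 1≤d x'-med x<x' = ≤-trans (#leftOf-mono (<⇒≤ x<x'))
    (≤-trans (median-#left≤1+#right 1≤d x'-med) (#rightOf-antimono-< x<x' (median-edge x'-med)))

  #right≤#left-after-median : ∀ {w x x'} → 1 ≤ deg E w → IsMed E w x' → toℕ x' < toℕ x →
                              #rightOf x w ≤ #leftOf x w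
  #right≤#left-after-median 1≤d x'-med x'<x = ≤-trans (#rightOf-antimono (<⇒≤ x'<x))
    (≤-trans (median-#right≤1+#left 1≤d x'-med) (#leftOf-mono-< x'<x (median-edge x'-med)))

  crossingsAt : (Fin n → Fin n) → Fin m × Fin n → Fin n → ℕ
  crossingsAt ρ e w = count (λ j → crossᵇ E ρ e (j , w)) (nbrs E w)

  crossings-decompose : ∀ ρ e → crossings E ρ e ≡ ∑[ w < n ] crossingsAt ρ e w
  crossings-decompose ρ e = begin
    crossings E ρ e                           ≡⟨ count-filterᵇ isEdge (crossᵇ E ρ e) pairs ⟩
    count c pairs                             ≡⟨ count-cartesianProduct c id (allFin n) ⟩
    ∑[ j < m ] count (c ∘ (j ,_)) (allFin n)  ≡⟨ sum-cong-≗ (λ j → count-tabulate (c ∘ (j ,_)) id) ⟩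
    ∑[ j < m ] ∑[ w < n ] δ j w               ≡⟨ ∑-comm δ ⟩
    ∑[ w < n ] ∑[ j < m ] δ j w               ≡⟨ sum-cong-≗ (λ w → count-tabulate (c ∘ (_, w)) id) ⟨
    ∑[ w < n ] count (c ∘ (_, w)) (allFin m)  ≡⟨ sum-cong-≗ (λ w → count-filterᵇ (flip E w) _ (allFin m)) ⟨
    ∑[ w < n ] crossingsAt ρ e w              ∎
    where
    open ≡-Reasoning
    pairs : List (Fin m × Fin n)
    pairs = cartesianProduct (allFin m) (allFin n)
    isEdge c : Fin m × Fin n → Bool
    isEdge (j , w) = E j w
    c f = isEdge f ∧ crossᵇ E ρ e f
    δ : Fin m → Fin n → ℕ
    δ j w = indicator (c (j , w))

  module _ (ρ : Fin n → Fin n) (x : Fin m) {y w : Fin n} where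

    crossingsAt-above : toℕ (ρ y) < toℕ (ρ w) → crossingsAt ρ (x , y) w ≡ #leftOf x w
    crossingsAt-above ρy<ρw = count-cong crossᵇ≡ (nbrs E w)
      where
      crossᵇ≡ : ∀ j → crossᵇ E ρ (x , y) (j , w) ≡ (toℕ j <ᵇ toℕ x)
      crossᵇ≡ j rewrite <ᵇ-false (<⇒≯ ρy<ρw) | <ᵇ-true ρy<ρw =
        cong₂ _∨_ (∧-zeroʳ (toℕ x <ᵇ toℕ j)) (∧-identityʳ (toℕ j <ᵇ toℕ x))

    crossingsAt-below : toℕ (ρ w) < toℕ (ρ y) → crossingsAt ρ (x , y) w ≡ #rightOf x w
    crossingsAt-below ρw<ρy = count-cong crossᵇ≡ (nbrs E w)
      where
      crossᵇ≡ : ∀ j → crossᵇ E ρ (x , y) (j , w) ≡ (toℕ x <ᵇ toℕ j)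
      crossᵇ≡ j rewrite <ᵇ-true ρw<ρy | <ᵇ-false (<⇒≯ ρw<ρy) =
        trans (cong₂ _∨_ (∧-identityʳ (toℕ x <ᵇ toℕ j)) (∧-zeroʳ (toℕ j <ᵇ toℕ x))) (∨-identityʳ _)

  crossingsAt-self : ∀ ρ x y → crossingsAt ρ (x , y) y ≡ 0
  crossingsAt-self ρ x y = count-none (All.universal (λ j → subst T (crossᵇ≡ j)) (nbrs E y))
    where
    crossᵇ≡ : ∀ j → crossᵇ E ρ (x , y) (j , y) ≡ false
    crossᵇ≡ j rewrite <ᵇ-false (n≮n (toℕ (ρ y))) =
      cong₂ _∨_ (∧-zeroʳ (toℕ x <ᵇ toℕ j)) (∧-zeroʳ (toℕ j <ᵇ toℕ x))

  order-toℕ-injective : ∀ {ρ : Fin n → Fin n} → IsOrder ρ → ∀ {u v} → toℕ (ρ u) ≡ toℕ (ρ v) → u ≡ v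
  order-toℕ-injective ρ-order eq = ρ-order (Fin.toℕ-injective eq)

  module _ {ρ : Fin n → Fin n} (ρ-order : IsOrder ρ) (x : Fin m) {y w : Fin n} (w≢y : w ≢ y) where

    ⊓≤crossingsAt : #leftOf x w ⊓ #rightOf x w ≤ crossingsAt ρ (x , y) w
    ⊓≤crossingsAt with <-cmp (toℕ (ρ y)) (toℕ (ρ w))
    ... | tri< ρy<ρw _ _ = ≤-trans (m⊓n≤m _ _) (≤-reflexive (sym (crossingsAt-above ρ x ρy<ρw)))
    ... | tri≈ _ ρy≡ρw _ = contradiction (order-toℕ-injective ρ-order (sym ρy≡ρw)) w≢y
    ... | tri> _ _ ρw<ρy = ≤-trans (m⊓n≤n _ _) (≤-reflexive (sym (crossingsAt-below ρ x ρw<ρy)))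

    crossingsAt≤⊔ : crossingsAt ρ (x , y) w ≤ #leftOf x w ⊔ #rightOf x w
    crossingsAt≤⊔ with <-cmp (toℕ (ρ y)) (toℕ (ρ w))
    ... | tri< ρy<ρw _ _ = ≤-trans (≤-reflexive (crossingsAt-above ρ x ρy<ρw)) (m≤m⊔n _ _)
    ... | tri≈ _ ρy≡ρw _ = contradiction (order-toℕ-injective ρ-order (sym ρy≡ρw)) w≢y
    ... | tri> _ _ ρw<ρy = ≤-trans (≤-reflexive (crossingsAt-below ρ x ρw<ρy)) (m≤n⊔m _ _)

  crossings≤lcn : ∀ ρ {x z} → T (E x z) → crossings E ρ (x , z) ≤ lcn E ρ
  crossings≤lcn ρ {x} {z} xz = ≤-foldr-⊔ (crossings E ρ)
    (∈-filter⁺ (T? ∘ λ e → E (proj₁ e) (proj₂ e)) (∈-cartesianProduct⁺ (∈-allFin x) (∈-allFin z)) xz)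

  two-counts : ∀ {w x} → 1 ≤ deg E w → IsMed E w x → rank E w ≡ 0 →
               #leftOf x w ≡ 1 × #rightOf x w ≡ 0
  two-counts 1≤d x-med r≡0 with medianSplit 1≤d x-med
  ... | two _ l≡1 ρ≡0 = l≡1 , ρ≡0
  ... | odd r≡1 _     = contradiction (trans (sym r≡0) r≡1) λ ()
  ... | even r≡2 _ _  = contradiction (trans (sym r≡0) r≡2) λ ()

  even-counts : ∀ {w x} → 1 ≤ deg E w → IsMed E w x → rank E w ≡ 2 →
                #rightOf x w ≡ suc (#leftOf x w) × deg E w ≡ 2 + #leftOf x w * 2
  even-counts 1≤d x-med r≡2 with medianSplit 1≤d x-med
  ... | two r≡0 _ _        = contradiction (trans (sym r≡0) r≡2) λ ()
  ... | odd r≡1 _          = contradiction (trans (sym r≡1) r≡2) λ ()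
  ... | even _ ρ≡1+l d≡2+2l = ρ≡1+l , d≡2+2l

  IsMed? : ∀ w x → Dec (IsMed E w x)
  IsMed? w x = Maybe.≡-dec Fin._≟_ _ _

  module MedianEdgeBound (deg≥1 : ∀ w → 1 ≤ deg E w)
                         {π : Fin n → Fin n} (heuristic : HeuristicA E π)
                         {σ : Fin n → Fin n} (σ-order : IsOrder σ)
                         {x : Fin m} {y : Fin n} (y-med : IsMed E y x) where

    π-order : IsOrder π
    π-order = proj₁ heuristic

    by-median : ∀ w₁ w₂ x₁ x₂ → IsMed E w₁ x₁ → IsMed E w₂ x₂ → toℕ x₁ < toℕ x₂ →
                toℕ (π w₁) < toℕ (π w₂)
    by-median = proj₁ (proj₂ heuristic)

    by-rank : ∀ w₁ w₂ x → IsMed E w₁ x → IsMed E w₂ x → rank E w₁ < rank E w₂ →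
              toℕ (π w₁) < toℕ (π w₂)
    by-rank = proj₁ (proj₂ (proj₂ heuristic))

    by-degree : ∀ w₁ w₂ x → IsMed E w₁ x → IsMed E w₂ x → rank E w₁ ≡ 2 → rank E w₂ ≡ 2 →
                deg E w₁ < deg E w₂ → toℕ (π w₁) < toℕ (π w₂)
    by-degree = proj₂ (proj₂ (proj₂ (proj₂ heuristic)))

    cπ : Fin n → ℕ
    cπ = crossingsAt π (x , y)

    cσ : Fin n → Fin n → ℕ
    cσ z = crossingsAt σ (x , z)

    minCrossings : Fin n → ℕ
    minCrossings w = #leftOf x w ⊓ #rightOf x w

    minCrossings≤cσ : ∀ {w z} → w ≢ z → minCrossings w ≤ cσ z w
    minCrossings≤cσ = ⊓≤crossingsAt σ-order x

    cπ-above : ∀ {w} → toℕ (π y) < toℕ (π w) → #leftOf x w ≤ #rightOf x w → cπ w ≤ minCrossings w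
    cπ-above πy<πw l≤r = ≤-reflexive (trans (crossingsAt-above π x πy<πw) (sym (m≤n⇒m⊓n≡m l≤r)))

    cπ-below : ∀ {w} → toℕ (π w) < toℕ (π y) → #rightOf x w ≤ #leftOf x w → cπ w ≤ minCrossings w
    cπ-below πw<πy r≤l = ≤-reflexive (trans (crossingsAt-below π x πw<πy) (sym (m≥n⇒m⊓n≡n r≤l)))

    outside-bunch : ∀ {w} → ¬ IsMed E w x → cπ w ≤ minCrossings w
    outside-bunch {w} w∉x with median-exists w (deg≥1 w)
    ... | x' , x'-med with <-cmp (toℕ x) (toℕ x')
    ... | tri< x<x' _ _ = cπ-above (by-median y w x x' y-med x'-med x<x')
                                   (#left≤#right-before-median (deg≥1 w) x'-med x<x')
    ... | tri≈ _ x≡x' _ = contradiction (subst (IsMed E w) (sym (Fin.toℕ-injective x≡x')) x'-med) w∉x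
    ... | tri> _ _ x'<x = cπ-below (by-median w y x' x x'-med y-med x'<x)
                                   (#right≤#left-after-median (deg≥1 w) x'-med x'<x)

    before-y : ∀ {w a b} → IsMed E w x → rank E w ≡ a → rank E y ≡ b → a < b →
               toℕ (π w) < toℕ (π y)
    before-y w-med refl refl = by-rank _ y x w-med y-med

    after-y : ∀ {w a b} → IsMed E w x → rank E y ≡ a → rank E w ≡ b → a < b →
              toℕ (π y) < toℕ (π w)
    after-y w-med refl refl = by-rank y _ x y-med w-med

    Two EarlyEven : Pred (Fin n) 0ℓ
    Two w       = IsMed E w x × rank E w ≡ 0
    EarlyEven w = IsMed E w x × rank E w ≡ 2 × (w ≡ y ⊎ toℕ (π w) < toℕ (π y))

    two? : Decidable Two
    two? w = IsMed? w x ×-dec rank E w ℕ.≟ 0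

    early-even? : Decidable EarlyEven
    early-even? w = IsMed? w x ×-dec rank E w ℕ.≟ 2 ×-dec (w Fin.≟ y ⊎-dec toℕ (π w) ℕ.<? toℕ (π y))

    data Contribution (w : Fin n) : Set where
      minimal          : cπ w ≤ minCrossings w → Contribution w
      both-two         : Two w → rank E y ≡ 0 → Contribution w
      even-before-even : IsMed E w x → rank E w ≡ 2 → rank E y ≡ 2 → toℕ (π w) < toℕ (π y) →
                         Contribution w

    contribution : ∀ w → w ≢ y → Contribution w
    contribution w w≢y with IsMed? w x
    ... | no w∉x = minimal (outside-bunch w∉x)
    ... | yes w-med with medianSplit (deg≥1 w) w-med | medianSplit (deg≥1 y) y-med
    ... | two rw _ _      | two ry _ _  = both-two (w-med , rw) ry
    ... | two rw _ ρ≡0    | odd ry _    =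
      minimal (cπ-below (before-y w-med rw ry (s≤s z≤n)) (≡0⇒≤ ρ≡0))
    ... | two rw _ ρ≡0    | even ry _ _ =
      minimal (cπ-below (before-y w-med rw ry (s≤s z≤n)) (≡0⇒≤ ρ≡0))
    ... | odd _ ρ≡l       | _           =
      minimal (≤-trans (crossingsAt≤⊔ π-order x w≢y) (≡⇒⊔≤⊓ ρ≡l))
    ... | even rw ρ≡1+l _ | two ry _ _  =
      minimal (cπ-above (after-y w-med ry rw (s≤s z≤n)) (≡suc⇒≤ ρ≡1+l))
    ... | even rw ρ≡1+l _ | odd ry _    =
      minimal (cπ-above (after-y w-med ry rw (s≤s (s≤s z≤n))) (≡suc⇒≤ ρ≡1+l))
    ... | even rw ρ≡1+l _ | even ry _ _ with <-cmp (toℕ (π w)) (toℕ (π y))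
    ...   | tri< πw<πy _ _ = even-before-even w-med rw ry πw<πy
    ...   | tri≈ _ πw≡πy _ = contradiction (order-toℕ-injective π-order πw≡πy) w≢y
    ...   | tri> _ _ πy<πw = minimal (cπ-above πy<πw (≡suc⇒≤ ρ≡1+l))

    σ-toℕ-≢ : ∀ {u v} → u ≢ v → toℕ (σ u) ≢ toℕ (σ v)
    σ-toℕ-≢ u≢v = u≢v ∘ order-toℕ-injective σ-order

    record Partner : Set where
      field
        z          : Fin n
        z-med      : IsMed E z x
        swap-bound : y ≢ z → cπ z ≤ cσ z y
        bound      : ∀ w → w ≢ y → w ≢ z → cπ w ≤ cσ z w

    partner-odd : rank E y ≡ 1 → Partner
    partner-odd r≡1 = record
      { z = y ; z-med = y-med ; swap-bound = λ y≢y → contradiction refl y≢y ; bound = bound }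
      where
      bound : ∀ w → w ≢ y → w ≢ y → cπ w ≤ cσ y w
      bound w w≢y _ with contribution w w≢y
      ... | minimal cπ≤min             = ≤-trans cπ≤min (minCrossings≤cσ w≢y)
      ... | both-two _ r≡0             = contradiction (trans (sym r≡1) r≡0) λ ()
      ... | even-before-even _ _ r≡2 _ = contradiction (trans (sym r≡1) r≡2) λ ()

    partner-two : rank E y ≡ 0 → Partner
    partner-two ry≡0 with ∃-argmin two? (toℕ ∘ σ) (y-med , ry≡0)
    ... | z , (z-med , rz≡0) , z-first = record
      { z = z ; z-med = z-med ; swap-bound = swap-bound ; bound = bound }
      where
      cσ≡1 : ∀ {w} → Two w → w ≢ z → cσ z w ≡ 1
      cσ≡1 {w} w-two@(w-med , rw≡0) w≢z = trans
        (crossingsAt-above σ x (≤∧≢⇒< (z-first w w-two) (σ-toℕ-≢ (w≢z ∘ sym))))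
        (proj₁ (two-counts (deg≥1 w) w-med rw≡0))

      cπ≤1 : ∀ {w} → Two w → w ≢ y → cπ w ≤ 1
      cπ≤1 {w} (w-med , rw≡0) w≢y with two-counts (deg≥1 w) w-med rw≡0
      ... | l≡1 , ρ≡0 = ≤-trans (crossingsAt≤⊔ π-order x w≢y) (≤-reflexive (cong₂ _⊔_ l≡1 ρ≡0))

      swap-bound : y ≢ z → cπ z ≤ cσ z y
      swap-bound y≢z = subst (cπ z ≤_) (sym (cσ≡1 (y-med , ry≡0) y≢z)) (cπ≤1 (z-med , rz≡0) (y≢z ∘ sym))

      bound : ∀ w → w ≢ y → w ≢ z → cπ w ≤ cσ z w
      bound w w≢y w≢z with contribution w w≢y
      ... | minimal cπ≤min             = ≤-trans cπ≤min (minCrossings≤cσ w≢z)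
      ... | both-two w-two _           = subst (cπ w ≤_) (sym (cσ≡1 w-two w≢z)) (cπ≤1 w-two w≢y)
      ... | even-before-even _ _ r≡2 _ = contradiction (trans (sym ry≡0) r≡2) λ ()

    partner-even : rank E y ≡ 2 → Partner
    partner-even ry≡2 with ∃-argmax early-even? (toℕ ∘ σ) (y-med , ry≡2 , inj₁ refl)
    ... | z , (z-med , rz≡2 , z-early) , z-last = record
      { z = z ; z-med = z-med ; swap-bound = swap-bound z-early ; bound = bound }
      where
      σ-before-z : ∀ {w} → EarlyEven w → w ≢ z → toℕ (σ w) < toℕ (σ z)
      σ-before-z w-early w≢z = ≤∧≢⇒< (z-last _ w-early) (σ-toℕ-≢ w≢z)

      swap-bound : z ≡ y ⊎ toℕ (π z) < toℕ (π y) → y ≢ z → cπ z ≤ cσ z y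
      swap-bound (inj₁ z≡y)  y≢z = contradiction (sym z≡y) y≢z
      swap-bound (inj₂ πz<πy) y≢z
        with even-counts (deg≥1 z) z-med rz≡2 | even-counts (deg≥1 y) y-med ry≡2
      ... | ρz≡1+lz , dz≡2+2lz | ρy≡1+ly , dy≡2+2ly = begin
        cπ z                   ≡⟨ crossingsAt-below π x πz<πy ⟩
        #rightOf x z           ≡⟨ ρz≡1+lz ⟩
        suc (#leftOf x z)      ≤⟨ s≤s (ℕ.*-cancelʳ-≤ _ _ 2 (ℕ.+-cancelˡ-≤ 2 _ _ dz≤dy)) ⟩
        suc (#leftOf x y)      ≡⟨ ρy≡1+ly ⟨
        #rightOf x y           ≡⟨ crossingsAt-below σ x (σ-before-z (y-med , ry≡2 , inj₁ refl) y≢z) ⟨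
        cσ z y                 ∎
        where
        open ℕ.≤-Reasoning
        dz≤dy : 2 + #leftOf x z * 2 ≤ 2 + #leftOf x y * 2
        dz≤dy = subst₂ _≤_ dz≡2+2lz dy≡2+2ly
          (ℕ.≮⇒≥ (λ dy<dz → ℕ.<-asym πz<πy (by-degree y z x y-med z-med ry≡2 rz≡2 dy<dz)))

      bound : ∀ w → w ≢ y → w ≢ z → cπ w ≤ cσ z w
      bound w w≢y w≢z with contribution w w≢y
      ... | minimal cπ≤min  = ≤-trans cπ≤min (minCrossings≤cσ w≢z)
      ... | both-two _ r≡0  = contradiction (trans (sym ry≡2) r≡0) λ ()
      ... | even-before-even w-med rw≡2 _ πw<πy = ≤-reflexive (trans
        (crossingsAt-below π x πw<πy)
        (sym (crossingsAt-below σ x (σ-before-z (w-med , rw≡2 , inj₂ πw<πy) w≢z))))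

    partner : Partner
    partner with medianSplit (deg≥1 y) y-med
    ... | two ry≡0 _ _  = partner-two ry≡0
    ... | odd ry≡1 _    = partner-odd ry≡1
    ... | even ry≡2 _ _ = partner-even ry≡2

    open Partner partner public

    ∑cπ≤∑cσ : ∑[ w < n ] cπ w ≤ ∑[ w < n ] cσ z w
    ∑cπ≤∑cσ = ∑-≤-swap y z (subst (_≤ cσ z z) (sym (crossingsAt-self π x y)) z≤n) swap-bound bound

lemma4 : ∀ {m n : ℕ} (E : Network m n) (k : ℕ) (π : Fin n → Fin n)
    → (∀ y → 1 ≤ deg E y)
    → OneSidedLCN≡ E k
    → HeuristicA E π
    → ∀ x y → IsMed E y x → crossings E π (x , y) ≤ k
lemma4 E k π deg≥1 ((σ , σ-order , lcn≡k) , _) heuristic x y y-med = begin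
  crossings E π (x , y)   ≡⟨ crossings-decompose E π (x , y) ⟩
  ∑[ w < _ ] cπ w          ≤⟨ ∑cπ≤∑cσ ⟩
  ∑[ w < _ ] cσ z w        ≡⟨ crossings-decompose E σ (x , z) ⟨
  crossings E σ (x , z)   ≤⟨ crossings≤lcn E σ (median-edge E z-med) ⟩
  lcn E σ                 ≡⟨ lcn≡k ⟩
  k                       ∎
  where
  open ℕ.≤-Reasoning
  open MedianEdgeBound E deg≥1 heuristic σ-order y-med
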